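{- Let $F_1$ and $F_2$ be finite subsets of $\mathbb{Z}^2$ such that $F_1$ is uniquely determined by its row and column sums and $|F_1| = |F_2|$. Let $2\alpha = \sum_{j\in\mathbb{Z}} |c_j^{(1)} - c_j^{(2)}| + \sum_{i\in\mathbb{Z}} |r_i^{(1)} - r_i^{(2)}|$. Then the symmetric difference $F_1 \bigtriangleup F_2$ is the disjoint union of $\alpha$ staircases.
   Context: For $i \in \mathbb{Z}$, row $i$ is the set $\{(x,y)\in\mathbb{Z}^2 : x = i\}$ and for $j\in\mathbb{Z}$, column $j$ is $\{(x,y)\in\mathbb{Z}^2: y=j\}$. For $h\in\{1,2\}$, the row sum $r_i^{(h)}$ is the number of points of $F_h$ in row $i$ and the column sum $c_j^{(h)}$ is the number of points of $F_h$ in column $j$. $F_1$ is uniquely determined by its row and column sums if no finite subset of $\mathbb{Z}^2$ other than $F_1$ has the same row sums and column sums as $F_1$. The quantity $\sum_j |c_j^{(1)}-c_j^{(2)}| + \sum_i |r_i^{(1)}-r_i^{(2)}|$ is always even, which is why it is written $2\alpha$ with $\alpha$ a nonnegative integer. A staircase (relative to $F_1,F_2$) is a finite sequence of points $(p_1, \ldots, p_n)$ of $\mathbb{Z}^2$ (identified with its set of points) such that (1) for each $1 \le i \le n-1$ one of $p_i, p_{i+1}$ lies in $F_1 \setminus F_2$ and the other in $F_2 \setminus F_1$; and (2) either for all $i$ the points $p_{2i}$ and $p_{2i+1}$ lie in the same column and $p_{2i+1}$ and $p_{2i+2}$ lie in the same row, or for all $i$ the points $p_{2i}$ and $p_{2i+1}$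 lie in the same row and $p_{2i+1}$ and $p_{2i+2}$ lie in the same column (whenever these points exist). In particular a single point of $F_1 \bigtriangleup F_2$ is a staircase. -}

module Defs where

open import Data.Bool using (Bool; true; false; not)
open import Data.Empty using (⊥)
open import Data.Integer using (ℤ)
import Data.Integer.Properties as ℤP
open import Data.List using (List; []; _∷_; _++_; map; filter; length; deduplicate)
open import Data.Nat.ListAction using (sum)
open import Data.List.Membership.Propositional using (_∈_; _∉_)
open import Data.List.Relation.Unary.All using (All)
open import Data.List.Relation.Unary.Any using (Any)
open import Data.List.Relation.Unary.AllPairs using (AllPairs)
open import Data.List.Relation.Unary.Unique.Propositional using (Unique)
open import Data.Nat using (ℕ; ∣_-_∣; _*_)
open import Data.Product using (_×_; _,_; proj₁; proj₂)
open import Data.Sum using (_⊎_)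
open import Data.Unit using (⊤)
open import Relation.Binary.PropositionalEquality using (_≡_)
open import Relation.Nullary using (¬_)

-- A point (x , y) of ℤ²; row i = {x = i}, column j = {y = j}.
Point : Set
Point = ℤ × ℤ

IsFinSet : List Point → Set
IsFinSet = Unique

rowSum : List Point → ℤ → ℕ
rowSum F i = length (filter (λ p → proj₁ p ℤP.≟ i) F)

colSum : List Point → ℤ → ℕ
colSum F j = length (filter (λ p → proj₂ p ℤP.≟ j) F)

SameSet : List Point → List Point → Set
SameSet F G = ∀ p → (p ∈ F → p ∈ G) × (p ∈ G → p ∈ F)

UniquelyDetermined : List Point → Set
UniquelyDetermined F =
  ∀ (G : List Point) → IsFinSet G →
  (∀ i → rowSum G i ≡ rowSum F i) →
  (∀ j → colSum G j ≡ colSum F j) →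
  SameSet G F

-- Σ_j |c_j^(1) - c_j^(2)| + Σ_i |r_i^(1) - r_i^(2)|; all terms outside the
-- (deduplicated) rows/columns occurring in F₁ ∪ F₂ vanish.
totalDiff : List Point → List Point → ℕ
totalDiff F₁ F₂ =
  sum (map (λ j → ∣ colSum F₁ j - colSum F₂ j ∣)
           (deduplicate ℤP._≟_ (map proj₂ (F₁ ++ F₂))))
  + sum (map (λ i → ∣ rowSum F₁ i - rowSum F₂ i ∣)
           (deduplicate ℤP._≟_ (map proj₁ (F₁ ++ F₂))))
  where open Data.Nat using (_+_)

InDiff : List Point → List Point → Point → Set
InDiff F G p = p ∈ F × p ∉ G

InSymDiff : List Point → List Point → Point → Set
InSymDiff F₁ F₂ p = InDiff F₁ F₂ p ⊎ InDiff F₂ F₁ p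

SameRow SameCol : Point → Point → Set
SameRow p q = proj₁ p ≡ proj₁ q
SameCol p q = proj₂ p ≡ proj₂ q

AltMembership : List Point → List Point → List Point → Set
AltMembership F₁ F₂ [] = ⊤
AltMembership F₁ F₂ (p ∷ []) = ⊤
AltMembership F₁ F₂ (p ∷ q ∷ rest) =
  ((InDiff F₁ F₂ p × InDiff F₂ F₁ q) ⊎ (InDiff F₂ F₁ p × InDiff F₁ F₂ q))
  × AltMembership F₁ F₂ (q ∷ rest)

-- condition (2): consecutive steps alternate same-row / same-column;
-- the flag says whether the next step must be in a common row (true)
-- or a common column (false).
AltSteps : Bool → List Point → Set
AltSteps b [] = ⊤
AltSteps b (p ∷ []) = ⊤
AltSteps true (p ∷ q ∷ rest) = SameRow p q × AltSteps false (q ∷ rest)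
AltSteps false (p ∷ q ∷ rest) = SameCol p q × AltSteps true (q ∷ rest)

IsStaircase : List Point → List Point → List Point → Set
IsStaircase F₁ F₂ s =
  ¬ (s ≡ []) × All (InSymDiff F₁ F₂) s × AltMembership F₁ F₂ s
  × (AltSteps true s ⊎ AltSteps false s)

Disjoint : List Point → List Point → Set
Disjoint s t = ∀ p → p ∈ s → p ∈ t → ⊥

IsStaircaseDecomposition : List Point → List Point → List (List Point) → Set
IsStaircaseDecomposition F₁ F₂ ss =
  All (IsStaircase F₁ F₂) ss
  × AllPairs Disjoint ss
  × (∀ p → (InSymDiff F₁ F₂ p → Any (p ∈_) ss) × (Any (p ∈_) ss → InSymDiff F₁ F₂ p))

module Submission where

-- Colour the points of F₁ △ F₂ by membership in F₁ and give every line (row or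
-- column) the charge of a point set: its number of points of colour F₁ minus
-- its number of points of colour F₂ on that line.  The charge of the whole
-- symmetric difference on a line is c⁽¹⁾ − c⁽²⁾ (or r⁽¹⁾ − r⁽²⁾), so 2α is the
-- potential Φ = Σ |charge|.  While Φ ≠ 0, start on a line of nonzero charge at a
-- point of the dominant colour and extend greedily to a maximal walk turning
-- alternately in rows and columns with alternating colours: a staircase.
-- Removing it lowers Φ by exactly 2.  When Φ = 0 the remaining set R has zero
-- charge on every line, so F₁ △ R has the row and column sums of F₁, and
-- uniqueness forces R = ∅.

open import Defs
open import Algebra.Properties.CommutativeSemigroup using (interchange)
open import Data.Bool using (Bool; true; false; not; if_then_else_)
import Data.Bool.Properties as 𝔹
open import Data.Empty using (⊥; ⊥-elim)
open import Data.Integer as ℤ using (ℤ; +_; -[1+_]; 0ℤ; 1ℤ; -1ℤ; _⊖_; ∣_∣)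
import Data.Integer.Properties as ℤP
open import Data.Integer.Solver using (module +-*-Solver)
open import Data.List using (List; []; _∷_; [_]; _++_; length; map; filter; concat; deduplicate)
open import Data.List.Properties using (length-++; filter-++; map-++; map-∘; map-cong)
open import Data.List.Membership.Propositional using (_∈_; _∉_; find; lose)
open import Data.List.Membership.Propositional.Properties
  using (∈-map⁺; ∈-map⁻; ∈-∃++; ∈-filter⁺; ∈-filter⁻; ∈-++⁺ˡ; ∈-++⁺ʳ; ∈-++⁻;
         ∈-deduplicate⁺; ∈-concat⁺; ∈-concat⁻; ∈-concat⁺′)
open import Data.List.Membership.Propositional.Properties.WithK using (unique∧set⇒bag)
import Data.List.Membership.DecPropositional as DecMembership
open import Data.List.Relation.Binary.BagAndSetEquality using (∼bag⇒↭)
open import Data.List.Relation.Binary.Permutation.Propositional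
  using (_↭_; refl; prep; swap; trans; ↭-refl; ↭-sym; ↭-trans; ↭⇒↭ₛ)
open import Data.List.Relation.Binary.Permutation.Propositional.Properties
  using (shift; filter-↭; ↭-length; ∈-resp-↭; All-resp-↭; ++⁺ˡ)
import Data.List.Relation.Binary.Permutation.Setoid.Properties as ↭ₛ
open import Data.List.Relation.Unary.All as All using (All; []; _∷_)
import Data.List.Relation.Unary.All.Properties as AllP
open import Data.List.Relation.Unary.Any using (here; there; any?)
open import Data.List.Relation.Unary.AllPairs using (AllPairs; []; _∷_)
open import Data.List.Relation.Unary.Unique.Propositional using (Unique)
import Data.List.Relation.Unary.Unique.Propositional.Properties as Uniqueₚ
open import Data.List.Relation.Unary.Unique.DecPropositional.Properties ℤP._≟_ using (deduplicate-!)
open import Data.Nat as ℕ using (ℕ; suc; zero; _*_; ∣_-_∣)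
import Data.Nat.Properties as ℕP
open import Data.Nat.ListAction using (sum)
open import Data.Nat.ListAction.Properties using (sum-++)
open import Data.Product using (Σ; _×_; _,_; proj₁; proj₂; ∃)
import Data.Product.Properties as ×P
open import Data.Sum using (_⊎_; inj₁; inj₂)
import Data.Sum.Properties as ⊎P
open import Data.Unit using (⊤; tt)
open import Function using (_∘_; _⇔_; mk⇔)
open import Relation.Binary.Definitions using (DecidableEquality)
open import Relation.Binary.PropositionalEquality
  using (_≡_; _≢_; refl; sym; cong; cong₂; subst; module ≡-Reasoning)
  renaming (trans to ≡-trans; setoid to ≡-setoid)
open import Relation.Nullary using (¬_; Dec; yes; no; does)
open import Relation.Nullary.Decidable using (dec-true; dec-false; _×-dec_)
open import Relation.Unary using (Pred; Decidable)
open import Relation.Unary.Properties using (∁?)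

open +-*-Solver using (solve; con; _:+_; _:*_; :-_; _:-_; _:=_)

module _ {A : Set} where

  Unique-++⁻ : ∀ (xs : List A) {ys} → Unique (xs ++ ys) → Unique ys × (∀ {x} → x ∈ xs → x ∉ ys)
  Unique-++⁻ [] u = u , λ ()
  Unique-++⁻ (x ∷ xs) (x∉ ∷ u) with Unique-++⁻ xs u
  ... | ys-unique , disjoint = ys-unique , λ
    { (here refl) x∈ys → All.lookup (AllP.++⁻ʳ xs x∉) x∈ys refl
    ; (there x∈xs) → disjoint x∈xs }

  Unique-resp-↭ : ∀ {xs ys : List A} → xs ↭ ys → Unique xs → Unique ys
  Unique-resp-↭ σ = ↭ₛ.Unique-resp-↭ (≡-setoid A) (↭⇒↭ₛ σ)

  unique∧sameMembers⇒↭ : ∀ {xs ys : List A} → Unique xs → Unique ys →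
                         (∀ {x} → x ∈ xs ⇔ x ∈ ys) → xs ↭ ys
  unique∧sameMembers⇒↭ xs-unique ys-unique same = ∼bag⇒↭ (unique∧set⇒bag xs-unique ys-unique same)

  filter-↭-partition : ∀ {p} {P : Pred A p} (P? : Decidable P) xs →
                       xs ↭ filter P? xs ++ filter (∁? P?) xs
  filter-↭-partition P? [] = refl
  filter-↭-partition P? (x ∷ xs) with P? x
  ... | yes _ = prep x (filter-↭-partition P? xs)
  ... | no _ = trans (prep x (filter-↭-partition P? xs))
                     (↭-sym (shift x (filter P? xs) (filter (∁? P?) xs)))

  module _ (_≟_ : DecidableEquality A) where
    open DecMembership _≟_ using (_∈?_)

    filter-∩-↭ : ∀ {xs ys} → Unique xs → Unique ys → filter (_∈? ys) xs ↭ filter (_∈? xs) ys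
    filter-∩-↭ {xs} {ys} xs-unique ys-unique =
      unique∧sameMembers⇒↭ (Uniqueₚ.filter⁺ (_∈? ys) xs-unique) (Uniqueₚ.filter⁺ (_∈? xs) ys-unique)
        (mk⇔ (swap-∩ xs ys) (swap-∩ ys xs))
      where
      swap-∩ : ∀ as bs {x} → x ∈ filter (_∈? bs) as → x ∈ filter (_∈? as) bs
      swap-∩ as bs m = let x∈as , x∈bs = ∈-filter⁻ (_∈? bs) m in ∈-filter⁺ (_∈? as) x∈bs x∈as

  sum-map-+ : ∀ (f g : A → ℕ) xs → sum (map (λ x → f x ℕ.+ g x) xs) ≡ sum (map f xs) ℕ.+ sum (map g xs)
  sum-map-+ f g [] = refl
  sum-map-+ f g (x ∷ xs) = begin
    f x ℕ.+ g x ℕ.+ sum (map (λ x → f x ℕ.+ g x) xs)    ≡⟨ cong (f x ℕ.+ g x ℕ.+_) (sum-map-+ f g xs) ⟩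
    f x ℕ.+ g x ℕ.+ (sum (map f xs) ℕ.+ sum (map g xs)) ≡⟨ interchange ℕP.+-commutativeSemigroup (f x) (g x) _ _ ⟩
    f x ℕ.+ sum (map f xs) ℕ.+ (g x ℕ.+ sum (map g xs)) ∎
    where open ≡-Reasoning

  sum-map≡0 : ∀ (f : A → ℕ) {xs x} → sum (map f xs) ≡ 0 → x ∈ xs → f x ≡ 0
  sum-map≡0 f {y ∷ _} Σ≡0 (here refl) = ℕP.m+n≡0⇒m≡0 (f y) Σ≡0
  sum-map≡0 f {y ∷ _} Σ≡0 (there x∈xs) = sum-map≡0 f (ℕP.m+n≡0⇒n≡0 (f y) Σ≡0) x∈xs

  sum-map≢0 : ∀ (f : A → ℕ) xs → sum (map f xs) ≢ 0 → ∃ λ x → x ∈ xs × f x ≢ 0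
  sum-map≢0 f [] Σ≢0 = ⊥-elim (Σ≢0 refl)
  sum-map≢0 f (x ∷ xs) Σ≢0 with f x ℕ.≟ 0
  ... | no fx≢0 = x , here refl , fx≢0
  ... | yes fx≡0 with sum-map≢0 f xs (Σ≢0 ∘ ≡-trans (cong (ℕ._+ sum (map f xs)) fx≡0))
  ...   | y , y∈xs , fy≢0 = y , there y∈xs , fy≢0

∣m-n∣≡∣m⊖n∣ : ∀ m n → ∣ m - n ∣ ≡ ∣ m ⊖ n ∣
∣m-n∣≡∣m⊖n∣ zero zero = refl
∣m-n∣≡∣m⊖n∣ zero (suc n) = refl
∣m-n∣≡∣m⊖n∣ (suc m) zero = refl
∣m-n∣≡∣m⊖n∣ (suc m) (suc n) = ≡-trans (∣m-n∣≡∣m⊖n∣ m n) (cong ∣_∣ (sym (ℤP.[1+m]⊖[1+n]≡m⊖n m n)))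

sgn : Bool → ℤ
sgn true = 1ℤ
sgn false = -1ℤ

sgn-not : ∀ c → sgn (not c) ≡ ℤ.- sgn c
sgn-not true = refl
sgn-not false = refl

-- Leans true e: e ≥ 0; Leans false e: e ≤ 0.  StrictlyLeans is the strict version.
data Leans : Bool → ℤ → Set where
  leans⁺ : ∀ n → Leans true (+ n)
  leans⁰ : Leans false 0ℤ
  leans⁻ : ∀ n → Leans false -[1+ n ]

StrictlyLeans : Bool → ℤ → Set
StrictlyLeans c e = Leans c (e ℤ.- sgn c)

Leans-0 : ∀ c → Leans c 0ℤ
Leans-0 true = leans⁺ 0
Leans-0 false = leans⁰

Leans-sgn+ : ∀ {c e} → Leans c e → Leans c (sgn c ℤ.+ e)
Leans-sgn+ (leans⁺ n) = leans⁺ (suc n)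
Leans-sgn+ leans⁰ = leans⁻ 0
Leans-sgn+ (leans⁻ n) = leans⁻ (suc n)

Leans⇒¬StrictlyLeans-not : ∀ {c e} → Leans (not c) e → ¬ StrictlyLeans c e
Leans⇒¬StrictlyLeans-not {true} leans⁰ ()
Leans⇒¬StrictlyLeans-not {true} (leans⁻ n) ()
Leans⇒¬StrictlyLeans-not {false} (leans⁺ zero) ()
Leans⇒¬StrictlyLeans-not {false} (leans⁺ (suc n)) ()

∣e∣≢0⇒StrictlyLeans : ∀ e → ∣ e ∣ ≢ 0 → ∃ λ c → StrictlyLeans c e
∣e∣≢0⇒StrictlyLeans (+ zero) e≢0 = ⊥-elim (e≢0 refl)
∣e∣≢0⇒StrictlyLeans (+ suc n) _ = true , leans⁺ n
∣e∣≢0⇒StrictlyLeans -[1+ zero ] _ = false , leans⁰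
∣e∣≢0⇒StrictlyLeans -[1+ suc n ] _ = false , leans⁻ n

∣e+sgn∣ : ∀ {c e} → Leans c e → ∣ e ℤ.+ sgn c ∣ ≡ suc ∣ e ∣
∣e+sgn∣ (leans⁺ n) = ℕP.+-comm n 1
∣e+sgn∣ leans⁰ = refl
∣e+sgn∣ (leans⁻ n) = cong (suc ∘ suc) (ℕP.+-identityʳ n)

Line : Set
Line = ℤ ⊎ ℤ

_≟ᴸ_ : DecidableEquality Line
_≟ᴸ_ = ⊎P.≡-dec ℤP._≟_ ℤP._≟_

rowOf colOf : Point → Line
rowOf p = inj₁ (proj₁ p)
colOf p = inj₂ (proj₂ p)

OnLine : Line → Point → Set
OnLine (inj₁ i) p = proj₁ p ≡ i
OnLine (inj₂ j) p = proj₂ p ≡ j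

onLine? : (u : Line) → Decidable (OnLine u)
onLine? (inj₁ i) p = proj₁ p ℤP.≟ i
onLine? (inj₂ j) p = proj₂ p ℤP.≟ j

count : Line → List Point → ℕ
count u xs = length (filter (onLine? u) xs)

count-++ : ∀ u xs ys → count u (xs ++ ys) ≡ count u xs ℕ.+ count u ys
count-++ u xs ys = ≡-trans (cong length (filter-++ (onLine? u) xs ys)) (length-++ (filter (onLine? u) xs))

count-↭ : ∀ u {xs ys} → xs ↭ ys → count u xs ≡ count u ys
count-↭ u = ↭-length ∘ filter-↭ (onLine? u)

count-partition : ∀ u {p} {P : Pred Point p} (P? : Decidable P) xs →
                  count u xs ≡ count u (filter P? xs) ℕ.+ count u (filter (∁? P?) xs)
count-partition u P? xs = ≡-trans (count-↭ u (filter-↭-partition P? xs)) (count-++ u (filter P? xs) _)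

δ : Line → Line → ℕ
δ u v = if does (u ≟ᴸ v) then 1 else 0

δ-refl : ∀ u → δ u u ≡ 1
δ-refl u = cong (λ b → if b then 1 else 0) (dec-true (u ≟ᴸ u) refl)

δ-≢ : ∀ {u v} → u ≢ v → δ u v ≡ 0
δ-≢ {u} {v} u≢v = cong (λ b → if b then 1 else 0) (dec-false (u ≟ᴸ v) u≢v)

sum-map-δ : ∀ {us v} → Unique us → v ∈ us → sum (map (λ u → δ u v) us) ≡ 1
sum-map-δ {u ∷ us} (u∉us ∷ _) (here refl) =
  cong₂ ℕ._+_ (δ-refl u) (absent u∉us)
  where
  absent : ∀ {ws} → All (u ≢_) ws → sum (map (λ w → δ w u) ws) ≡ 0
  absent [] = refl
  absent (u≢w ∷ u∉ws) = cong₂ ℕ._+_ (δ-≢ (u≢w ∘ sym)) (absent u∉ws)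
sum-map-δ {u ∷ us} {v} (u∉us ∷ us-unique) (there v∈us) =
  cong₂ ℕ._+_ (δ-≢ {u} {v} λ { refl → All.lookup u∉us v∈us refl }) (sum-map-δ us-unique v∈us)

∣e+sgn*δ∣ : ∀ {c e} u v → (u ≡ v → Leans c e) → ∣ e ℤ.+ sgn c ℤ.* + δ u v ∣ ≡ ∣ e ∣ ℕ.+ δ u v
∣e+sgn*δ∣ {c} {e} u v leans with u ≟ᴸ v
... | yes refl = begin
  ∣ e ℤ.+ sgn c ℤ.* 1ℤ ∣   ≡⟨ cong (λ z → ∣ e ℤ.+ z ∣) (ℤP.*-identityʳ (sgn c)) ⟩
  ∣ e ℤ.+ sgn c ∣          ≡⟨ ∣e+sgn∣ (leans refl) ⟩
  suc ∣ e ∣                ≡⟨ ℕP.+-comm 1 ∣ e ∣ ⟩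
  ∣ e ∣ ℕ.+ 1              ∎
  where open ≡-Reasoning
... | no _ = begin
  ∣ e ℤ.+ sgn c ℤ.* 0ℤ ∣   ≡⟨ cong (λ z → ∣ e ℤ.+ z ∣) (ℤP.*-zeroʳ (sgn c)) ⟩
  ∣ e ℤ.+ 0ℤ ∣             ≡⟨ cong ∣_∣ (ℤP.+-identityʳ e) ⟩
  ∣ e ∣                    ≡⟨ ℕP.+-identityʳ ∣ e ∣ ⟨
  ∣ e ∣ ℕ.+ 0              ∎
  where open ≡-Reasoning

-- The two loose ends of a peeled walk, at lines v and w, each move the charge
-- of their line away from zero.
∣charge∣-peel : ∀ {σ ℓ} {e₀ e₁ : Line → ℤ} v w →
  (∀ u → e₀ u ≡ e₁ u ℤ.+ sgn ℓ ℤ.* + δ u w ℤ.+ sgn σ ℤ.* + δ u v) →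
  StrictlyLeans σ (e₀ v) → Leans ℓ (e₁ w) →
  ∀ u → ∣ e₀ u ∣ ≡ ∣ e₁ u ∣ ℕ.+ δ u w ℕ.+ δ u v
∣charge∣-peel {σ} {ℓ} {e₀} {e₁} v w e₀≡ strict leans u = begin
  ∣ e₀ u ∣                                ≡⟨ cong ∣_∣ (e₀≡ u) ⟩
  ∣ mid u ℤ.+ sgn σ ℤ.* + δ u v ∣         ≡⟨ ∣e+sgn*δ∣ {σ} {mid u} u v (λ { refl → subst (Leans σ) e₀-sgn≡mid strict }) ⟩
  ∣ mid u ∣ ℕ.+ δ u v                     ≡⟨ cong (ℕ._+ δ u v) (∣e+sgn*δ∣ {ℓ} {e₁ u} u w λ { refl → leans }) ⟩
  ∣ e₁ u ∣ ℕ.+ δ u w ℕ.+ δ u v            ∎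
  where
  open ≡-Reasoning
  mid : Line → ℤ
  mid u = e₁ u ℤ.+ sgn ℓ ℤ.* + δ u w
  e₀-sgn≡mid : e₀ v ℤ.- sgn σ ≡ mid v
  e₀-sgn≡mid = begin
    e₀ v ℤ.- sgn σ                           ≡⟨ cong (λ e → e ℤ.- sgn σ) (e₀≡ v) ⟩
    mid v ℤ.+ sgn σ ℤ.* + δ v v ℤ.- sgn σ    ≡⟨ cong (λ n → mid v ℤ.+ sgn σ ℤ.* + n ℤ.- sgn σ) (δ-refl v) ⟩
    mid v ℤ.+ sgn σ ℤ.* 1ℤ ℤ.- sgn σ         ≡⟨ solve 2 (λ m s → m :+ s :* con 1ℤ :- s := m) refl (mid v) (sgn σ) ⟩
    mid v                                    ∎

sum-map-+δ+δ : ∀ {us} (f g : Line → ℕ) {v w} → Unique us → v ∈ us → w ∈ us →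
               (∀ u → f u ≡ g u ℕ.+ δ u w ℕ.+ δ u v) → sum (map f us) ≡ sum (map g us) ℕ.+ 2
sum-map-+δ+δ {us} f g {v} {w} us-unique v∈us w∈us f≡ = begin
  sum (map f us)
    ≡⟨ cong sum (map-cong f≡ us) ⟩
  sum (map (λ u → g u ℕ.+ δ u w ℕ.+ δ u v) us)
    ≡⟨ sum-map-+ (λ u → g u ℕ.+ δ u w) (λ u → δ u v) us ⟩
  sum (map (λ u → g u ℕ.+ δ u w) us) ℕ.+ sum (map (λ u → δ u v) us)
    ≡⟨ cong₂ ℕ._+_ (sum-map-+ g (λ u → δ u w) us) (sum-map-δ us-unique v∈us) ⟩
  sum (map g us) ℕ.+ sum (map (λ u → δ u w) us) ℕ.+ 1
    ≡⟨ cong (λ n → sum (map g us) ℕ.+ n ℕ.+ 1) (sum-map-δ us-unique w∈us) ⟩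
  sum (map g us) ℕ.+ 1 ℕ.+ 1
    ≡⟨ ℕP.+-assoc (sum (map g us)) 1 1 ⟩
  sum (map g us) ℕ.+ 2 ∎
  where open ≡-Reasoning

-- A walk p ∷ t whose first step goes along a row (b = true) or a column
-- (b = false) enters p through startLine b p and leaves its last point
-- through endLine b p t.
stepLine startLine : Bool → Point → Line
stepLine true = rowOf
stepLine false = colOf
startLine true = colOf
startLine false = rowOf

endPoint : Point → List Point → Point
endPoint p [] = p
endPoint p (q ∷ t) = endPoint q t

endLine : Bool → Point → List Point → Line
endLine b p [] = stepLine b p
endLine b p (q ∷ t) = endLine (not b) q t

endPoint-∈ : ∀ p t → endPoint p t ∈ p ∷ t
endPoint-∈ p [] = here refl
endPoint-∈ p (q ∷ t) = there (endPoint-∈ q t)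

onLine-stepLine : ∀ b p → OnLine (stepLine b p) p
onLine-stepLine true p = refl
onLine-stepLine false p = refl

onLine-endLine : ∀ b p t → OnLine (endLine b p t) (endPoint p t)
onLine-endLine b p [] = onLine-stepLine b p
onLine-endLine b p (q ∷ t) = onLine-endLine (not b) q t

δ-row+δ-col : ∀ b p u → δ u (rowOf p) ℕ.+ δ u (colOf p) ≡ δ u (startLine b p) ℕ.+ δ u (stepLine b p)
δ-row+δ-col true p u = ℕP.+-comm (δ u (rowOf p)) (δ u (colOf p))
δ-row+δ-col false p u = refl

startLine-onLine : ∀ u p → OnLine u p → ∃ λ b → startLine b p ≡ u
startLine-onLine (inj₁ i) p refl = false , refl
startLine-onLine (inj₂ j) p refl = true , refl

AltSteps-singleton : ∀ b p → AltSteps b (p ∷ [])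
AltSteps-singleton true p = tt
AltSteps-singleton false p = tt

AltSteps-∷ : ∀ b p q t → OnLine (stepLine b p) q → AltSteps (not b) (q ∷ t) → AltSteps b (p ∷ q ∷ t)
AltSteps-∷ true p q t q-on steps = sym q-on , steps
AltSteps-∷ false p q t q-on steps = sym q-on , steps

AltSteps-either : ∀ b xs → AltSteps b xs → AltSteps true xs ⊎ AltSteps false xs
AltSteps-either true xs = inj₁
AltSteps-either false xs = inj₂

AltSteps-tail : ∀ b p q t → AltSteps b (p ∷ q ∷ t) → AltSteps (not b) (q ∷ t)
AltSteps-tail true p q t = proj₂
AltSteps-tail false p q t = proj₂

AltSteps-turn : ∀ b p q t → AltSteps b (p ∷ q ∷ t) → startLine (not b) q ≡ stepLine b p
AltSteps-turn true p q t (same , _) = cong inj₁ (sym same)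
AltSteps-turn false p q t (same , _) = cong inj₂ (sym same)

module Colouring (colour : Point → Bool) where

  weight : Line → Point → ℤ
  weight u x = if does (onLine? u x) then sgn (colour x) else 0ℤ

  charge : List Point → Line → ℤ
  charge [] u = 0ℤ
  charge (x ∷ xs) u = weight u x ℤ.+ charge xs u

  weight≡sgn*δ : ∀ u x → weight u x ≡ sgn (colour x) ℤ.* + (δ u (rowOf x) ℕ.+ δ u (colOf x))
  weight≡sgn*δ (inj₁ i) x with proj₁ x ℤP.≟ i
  ... | yes refl rewrite δ-refl (rowOf x) = sym (ℤP.*-identityʳ (sgn (colour x)))
  ... | no off rewrite δ-≢ {inj₁ i} {rowOf x} (off ∘ sym ∘ ⊎P.inj₁-injective) = sym (ℤP.*-zeroʳ (sgn (colour x)))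
  weight≡sgn*δ (inj₂ j) x with proj₂ x ℤP.≟ j
  ... | yes refl rewrite δ-refl (colOf x) = sym (ℤP.*-identityʳ (sgn (colour x)))
  ... | no off rewrite δ-≢ {inj₂ j} {colOf x} (off ∘ sym ∘ ⊎P.inj₂-injective) = sym (ℤP.*-zeroʳ (sgn (colour x)))

  charge-++ : ∀ xs ys u → charge (xs ++ ys) u ≡ charge xs u ℤ.+ charge ys u
  charge-++ [] ys u = sym (ℤP.+-identityˡ (charge ys u))
  charge-++ (x ∷ xs) ys u = ≡-trans (cong (ℤ._+_ (weight u x)) (charge-++ xs ys u))
                                    (sym (ℤP.+-assoc (weight u x) (charge xs u) (charge ys u)))

  charge-↭ : ∀ {xs ys} → xs ↭ ys → ∀ u → charge xs u ≡ charge ys u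
  charge-↭ refl u = refl
  charge-↭ (prep x σ) u = cong (ℤ._+_ (weight u x)) (charge-↭ σ u)
  charge-↭ (swap x y σ) u =
    ≡-trans (solve 3 (λ a b c → a :+ (b :+ c) := b :+ (a :+ c)) refl (weight u x) (weight u y) _)
            (cong (λ e → weight u y ℤ.+ (weight u x ℤ.+ e)) (charge-↭ σ u))
  charge-↭ (trans σ τ) u = ≡-trans (charge-↭ σ u) (charge-↭ τ u)

  charge-monochrome : ∀ {c} xs u → All (λ x → colour x ≡ c) xs → charge xs u ≡ sgn c ℤ.* + count u xs
  charge-monochrome {c} [] u [] = sym (ℤP.*-zeroʳ (sgn c))
  charge-monochrome {c} (x ∷ xs) u (x-c ∷ xs-c) with onLine? u x
  ... | yes _ = begin
    sgn (colour x) ℤ.+ charge xs u      ≡⟨ cong₂ ℤ._+_ (cong sgn x-c) (charge-monochrome xs u xs-c) ⟩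
    sgn c ℤ.+ sgn c ℤ.* + count u xs    ≡⟨ solve 2 (λ s n → s :+ s :* n := s :* (con 1ℤ :+ n)) refl (sgn c) _ ⟩
    sgn c ℤ.* (1ℤ ℤ.+ + count u xs)     ∎
    where open ≡-Reasoning
  ... | no _ = ≡-trans (ℤP.+-identityˡ _) (charge-monochrome xs u xs-c)

  Leans-charge : ∀ {c u} xs → (∀ {x} → x ∈ xs → OnLine u x → colour x ≡ c) → Leans c (charge xs u)
  Leans-charge {c} [] _ = Leans-0 c
  Leans-charge {c} {u} (x ∷ xs) same with onLine? u x
  ... | yes on = subst (λ c′ → Leans c (sgn c′ ℤ.+ charge xs u)) (sym (same (here refl) on))
                       (Leans-sgn+ (Leans-charge xs (same ∘ there)))
  ... | no _ = subst (Leans c) (sym (ℤP.+-identityˡ _)) (Leans-charge xs (same ∘ there))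

  StrictlyLeans⇒witness : ∀ {c u} xs → StrictlyLeans c (charge xs u) →
                          ∃ λ x → x ∈ xs × OnLine u x × colour x ≡ c
  StrictlyLeans⇒witness {c} {u} xs strict
    with any? (λ x → onLine? u x ×-dec (colour x 𝔹.≟ c)) xs
  ... | yes found = let x , x∈xs , on , x-c = find found in x , x∈xs , on , x-c
  ... | no none = ⊥-elim (Leans⇒¬StrictlyLeans-not (Leans-charge xs other) strict)
    where
    other : ∀ {x} → x ∈ xs → OnLine u x → colour x ≡ not c
    other x∈xs on = 𝔹.¬-not λ x-c → none (lose x∈xs (on , x-c))

  Alternating : List Point → Set
  Alternating [] = ⊤
  Alternating (x ∷ []) = ⊤
  Alternating (x ∷ y ∷ t) = colour y ≡ not (colour x) × Alternating (y ∷ t)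

  weight-startLine-stepLine : ∀ b u p →
    weight u p ≡ sgn (colour p) ℤ.* + δ u (startLine b p) ℤ.+ sgn (colour p) ℤ.* + δ u (stepLine b p)
  weight-startLine-stepLine b u p = begin
    weight u p                                                 ≡⟨ weight≡sgn*δ u p ⟩
    s ℤ.* + (δ u (rowOf p) ℕ.+ δ u (colOf p))                  ≡⟨ cong (λ n → s ℤ.* + n) (δ-row+δ-col b p u) ⟩
    s ℤ.* + (δ u (startLine b p) ℕ.+ δ u (stepLine b p))       ≡⟨ cong (s ℤ.*_) (ℤP.pos-+ (δ u (startLine b p)) _) ⟩
    s ℤ.* (+ δ u (startLine b p) ℤ.+ + δ u (stepLine b p))     ≡⟨ ℤP.*-distribˡ-+ s _ _ ⟩
    s ℤ.* + δ u (startLine b p) ℤ.+ s ℤ.* + δ u (stepLine b p) ∎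
    where
    open ≡-Reasoning
    s : ℤ
    s = sgn (colour p)

  -- Along an alternating walk the charges cancel on every line where it turns,
  -- leaving only its two loose ends.
  charge-walk : ∀ b p t → AltSteps b (p ∷ t) → Alternating (p ∷ t) → ∀ u →
    charge (p ∷ t) u ≡ sgn (colour p) ℤ.* + δ u (startLine b p)
                       ℤ.+ sgn (colour (endPoint p t)) ℤ.* + δ u (endLine b p t)
  charge-walk b p [] _ _ u = ≡-trans (ℤP.+-identityʳ _) (weight-startLine-stepLine b u p)
  charge-walk b p (q ∷ t) steps (q-colour , alternating) u = begin
    weight u p ℤ.+ charge (q ∷ t) u
      ≡⟨ cong₂ ℤ._+_ (weight-startLine-stepLine b u p)
                     (charge-walk (not b) q t (AltSteps-tail b p q t steps) alternating u) ⟩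
    s ℤ.* + a ℤ.+ s ℤ.* + c ℤ.+ (sgn (colour q) ℤ.* + δ u (startLine (not b) q) ℤ.+ L)
      ≡⟨ cong₂ (λ s′ v → s ℤ.* + a ℤ.+ s ℤ.* + c ℤ.+ (s′ ℤ.* + δ u v ℤ.+ L))
               (≡-trans (cong sgn q-colour) (sgn-not (colour p))) (AltSteps-turn b p q t steps) ⟩
    s ℤ.* + a ℤ.+ s ℤ.* + c ℤ.+ (ℤ.- s ℤ.* + c ℤ.+ L)
      ≡⟨ solve 4 (λ s a c l → s :* a :+ s :* c :+ ((:- s) :* c :+ l) := s :* a :+ l) refl s (+ a) (+ c) L ⟩
    s ℤ.* + a ℤ.+ L ∎
    where
    open ≡-Reasoning
    s : ℤ
    s = sgn (colour p)
    a c : ℕ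
    a = δ u (startLine b p)
    c = δ u (stepLine b p)
    L : ℤ
    L = sgn (colour (endPoint q t)) ℤ.* + δ u (endLine (not b) q t)

  record MaximalWalk (xs : List Point) (b : Bool) (p : Point) : Set where
    field
      trail rest : List Point
      steps : AltSteps b (p ∷ trail)
      alternating : Alternating (p ∷ trail)
      split : xs ↭ trail ++ rest
      maximal : ∀ {x} → x ∈ rest → OnLine (endLine b p trail) x → colour x ≡ colour (endPoint p trail)

  NextOf : Bool → Point → Point → Set
  NextOf b p x = OnLine (stepLine b p) x × colour x ≡ not (colour p)

  stuck : ∀ {xs} b p → (∀ {x} → x ∈ xs → ¬ NextOf b p x) → MaximalWalk xs b p
  stuck {xs} b p none = record
    { trail = [] ; rest = xs ; steps = AltSteps-singleton b p ; alternating = tt ; split = ↭-refl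
    ; maximal = λ x∈xs on → ≡-trans (𝔹.¬-not (none x∈xs ∘ (on ,_))) (𝔹.not-involutive (colour p)) }

  maximalWalk : ∀ n xs → length xs ≡ n → ∀ b p → MaximalWalk xs b p
  maximalWalk zero [] _ b p = stuck b p λ ()
  maximalWalk (suc n) xs len b p with any? (λ x → onLine? (stepLine b p) x ×-dec (colour x 𝔹.≟ not (colour p))) xs
  ... | no none = stuck b p λ x∈xs next → none (lose x∈xs next)
  ... | yes found with find found
  ...   | q , q∈xs , q-on , q-colour with ∈-∃++ q∈xs
  ...     | as , bs , refl = record
    { trail = q ∷ W.trail
    ; rest = W.rest
    ; steps = AltSteps-∷ b p q W.trail q-on W.steps
    ; alternating = q-colour , W.alternating
    ; split = ↭-trans (shift q as bs) (prep q W.split)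
    ; maximal = W.maximal
    }
    where
    len′ : length (as ++ bs) ≡ n
    len′ = ℕP.suc-injective (≡-trans (sym (↭-length (shift q as bs))) len)
    module W = MaximalWalk (maximalWalk n (as ++ bs) len′ (not b) q)

  module Potential (lines : List Line) (lines-unique : Unique lines) where

    Φ : List Point → ℕ
    Φ xs = sum (map (λ u → ∣ charge xs u ∣) lines)

    Covered : List Point → Set
    Covered xs = ∀ {x} u → x ∈ xs → OnLine u x → u ∈ lines

    Φ≡0⇒balanced : ∀ {xs} → Covered xs → Φ xs ≡ 0 → ∀ u → charge xs u ≡ 0ℤ
    Φ≡0⇒balanced {xs} covered Φ≡0 u with ∣ charge xs u ∣ ℕ.≟ 0
    ... | yes ∣e∣≡0 = ℤP.∣i∣≡0⇒i≡0 ∣e∣≡0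
    ... | no ∣e∣≢0 =
      let c , strict = ∣e∣≢0⇒StrictlyLeans (charge xs u) ∣e∣≢0
          x , x∈xs , on , _ = StrictlyLeans⇒witness {c} {u} xs strict
      in ⊥-elim (∣e∣≢0 (sum-map≡0 (λ u → ∣ charge xs u ∣) Φ≡0 (covered u x∈xs on)))

    record Peeling (xs : List Point) : Set where
      field
        start : Point
        trail rest : List Point
        direction : Bool
        steps : AltSteps direction (start ∷ trail)
        alternating : Alternating (start ∷ trail)
        split : xs ↭ (start ∷ trail) ++ rest
        Φ-drop : Φ xs ≡ Φ rest ℕ.+ 2

    -- The walk starts on a line v of nonzero charge at a point of the dominant
    -- colour; its far end cannot be continued, so the rest of the set leans
    -- towards the colour of the last point on the last line.
    peel : ∀ xs → Covered xs → Φ xs ≢ 0 → Peeling xs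
    peel xs covered Φ≢0 with sum-map≢0 (λ u → ∣ charge xs u ∣) lines Φ≢0
    ... | v , v∈lines , ∣e∣≢0 with ∣e∣≢0⇒StrictlyLeans (charge xs v) ∣e∣≢0
    ... | σ , strict with StrictlyLeans⇒witness xs strict
    ... | p , p∈xs , p-on , p-colour with ∈-∃++ p∈xs | startLine-onLine v p p-on
    ... | as , bs , refl | b , start≡v = record
      { start = p ; trail = W.trail ; rest = W.rest ; direction = b
      ; steps = W.steps ; alternating = W.alternating ; split = split ; Φ-drop = Φ-drop }
      where
      module W = MaximalWalk (maximalWalk _ (as ++ bs) refl b p)
      w : Line
      w = endLine b p W.trail
      ℓ : Bool
      ℓ = colour (endPoint p W.trail)
      split : as ++ [ p ] ++ bs ↭ (p ∷ W.trail) ++ W.rest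
      split = ↭-trans (shift p as bs) (prep p W.split)

      charge≡ : ∀ u → charge (as ++ [ p ] ++ bs) u ≡ charge W.rest u ℤ.+ sgn ℓ ℤ.* + δ u w ℤ.+ sgn σ ℤ.* + δ u v
      charge≡ u = begin
        charge (as ++ [ p ] ++ bs) u
          ≡⟨ charge-↭ split u ⟩
        charge ((p ∷ W.trail) ++ W.rest) u
          ≡⟨ charge-++ (p ∷ W.trail) W.rest u ⟩
        charge (p ∷ W.trail) u ℤ.+ charge W.rest u
          ≡⟨ cong (ℤ._+ charge W.rest u) (charge-walk b p W.trail W.steps W.alternating u) ⟩
        sgn (colour p) ℤ.* + δ u (startLine b p) ℤ.+ sgn ℓ ℤ.* + δ u w ℤ.+ charge W.rest u
          ≡⟨ cong₂ (λ c v′ → sgn c ℤ.* + δ u v′ ℤ.+ sgn ℓ ℤ.* + δ u w ℤ.+ charge W.rest u) p-colour start≡v ⟩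
        sgn σ ℤ.* + δ u v ℤ.+ sgn ℓ ℤ.* + δ u w ℤ.+ charge W.rest u
          ≡⟨ solve 3 (λ a b r → a :+ b :+ r := r :+ b :+ a) refl (sgn σ ℤ.* + δ u v) (sgn ℓ ℤ.* + δ u w) _ ⟩
        charge W.rest u ℤ.+ sgn ℓ ℤ.* + δ u w ℤ.+ sgn σ ℤ.* + δ u v ∎
        where open ≡-Reasoning

      w∈lines : w ∈ lines
      w∈lines = covered w (∈-resp-↭ (↭-sym split) (∈-++⁺ˡ (endPoint-∈ p W.trail))) (onLine-endLine b p W.trail)

      Φ-drop : Φ (as ++ [ p ] ++ bs) ≡ Φ W.rest ℕ.+ 2
      Φ-drop = sum-map-+δ+δ _ _ lines-unique v∈lines w∈lines
                 (∣charge∣-peel {e₁ = charge W.rest} v w charge≡ strict (Leans-charge W.rest W.maximal))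

_≟ᴾ_ : DecidableEquality Point
_≟ᴾ_ = ×P.≡-dec ℤP._≟_ ℤP._≟_

module Staircases (F₁ F₂ : List Point) where
  open DecMembership _≟ᴾ_ using (_∈?_; _∉?_)

  colour : Point → Bool
  colour x = does (x ∈? F₁)

  open Colouring colour

  charge-⊆F₁ : ∀ xs u → (∀ {x} → x ∈ xs → x ∈ F₁) → charge xs u ≡ + count u xs
  charge-⊆F₁ xs u ⊆F₁ =
    ≡-trans (charge-monochrome xs u (All.tabulate (dec-true (_ ∈? F₁) ∘ ⊆F₁))) (ℤP.*-identityˡ _)

  charge-⊆∁F₁ : ∀ xs u → (∀ {x} → x ∈ xs → x ∉ F₁) → charge xs u ≡ ℤ.- + count u xs
  charge-⊆∁F₁ xs u ⊆∁F₁ =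
    ≡-trans (charge-monochrome xs u (All.tabulate (dec-false (_ ∈? F₁) ∘ ⊆∁F₁))) (ℤP.-1*i≡-i _)

  charge-count : ∀ xs u → charge xs u ≡ + count u (filter (_∈? F₁) xs) ℤ.- + count u (filter (_∉? F₁) xs)
  charge-count xs u = begin
    charge xs u
      ≡⟨ charge-↭ (filter-↭-partition (_∈? F₁) xs) u ⟩
    charge (filter (_∈? F₁) xs ++ filter (_∉? F₁) xs) u
      ≡⟨ charge-++ (filter (_∈? F₁) xs) _ u ⟩
    charge (filter (_∈? F₁) xs) u ℤ.+ charge (filter (_∉? F₁) xs) u
      ≡⟨ cong₂ ℤ._+_ (charge-⊆F₁ _ u (proj₂ ∘ ∈-filter⁻ (_∈? F₁) {xs = xs}))
                     (charge-⊆∁F₁ _ u (proj₂ ∘ ∈-filter⁻ (_∉? F₁) {xs = xs})) ⟩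
    + count u (filter (_∈? F₁) xs) ℤ.- + count u (filter (_∉? F₁) xs) ∎
    where open ≡-Reasoning

  switch : List Point → List Point
  switch xs = filter (_∉? xs) F₁ ++ filter (_∉? F₁) xs

  switch-unique : Unique F₁ → ∀ {xs} → Unique xs → Unique (switch xs)
  switch-unique F₁-unique {xs} xs-unique =
    Uniqueₚ.++⁺ (Uniqueₚ.filter⁺ (_∉? xs) F₁-unique) (Uniqueₚ.filter⁺ (_∉? F₁) xs-unique)
      λ (l , r) → proj₂ (∈-filter⁻ (_∉? F₁) {xs = xs} r) (proj₁ (∈-filter⁻ (_∉? xs) {xs = F₁} l))

  count-switch : Unique F₁ → ∀ {xs} → Unique xs → (∀ u → charge xs u ≡ 0ℤ) →
                 ∀ u → count u (switch xs) ≡ count u F₁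
  count-switch F₁-unique {xs} xs-unique balanced u = begin
    count u (switch xs)
      ≡⟨ count-++ u (filter (_∉? xs) F₁) _ ⟩
    count u (filter (_∉? xs) F₁) ℕ.+ count u (filter (_∉? F₁) xs)
      ≡⟨ cong (count u (filter (_∉? xs) F₁) ℕ.+_) (sym same-count) ⟩
    count u (filter (_∉? xs) F₁) ℕ.+ count u (filter (_∈? F₁) xs)
      ≡⟨ cong (count u (filter (_∉? xs) F₁) ℕ.+_) (count-↭ u (filter-∩-↭ _≟ᴾ_ xs-unique F₁-unique)) ⟩
    count u (filter (_∉? xs) F₁) ℕ.+ count u (filter (_∈? xs) F₁)
      ≡⟨ ℕP.+-comm (count u (filter (_∉? xs) F₁)) _ ⟩
    count u (filter (_∈? xs) F₁) ℕ.+ count u (filter (_∉? xs) F₁)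
      ≡⟨ count-partition u (_∈? xs) F₁ ⟨
    count u F₁ ∎
    where
    open ≡-Reasoning
    same-count : count u (filter (_∈? F₁) xs) ≡ count u (filter (_∉? F₁) xs)
    same-count = ℤP.+-injective (ℤP.i-j≡0⇒i≡j _ _ (≡-trans (sym (charge-count xs u)) (balanced u)))

  balanced⇒empty : Unique F₁ → UniquelyDetermined F₁ → ∀ {xs} → Unique xs →
                   (∀ u → charge xs u ≡ 0ℤ) → ∀ {x} → x ∉ xs
  balanced⇒empty F₁-unique determined {xs} xs-unique balanced {x} x∈xs = by-side (x ∈? F₁)
    where
    same : SameSet (switch xs) F₁
    same = determined (switch xs) (switch-unique F₁-unique xs-unique)
             (λ i → count-switch F₁-unique xs-unique balanced (inj₁ i))
             (λ j → count-switch F₁-unique xs-unique balanced (inj₂ j))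
    by-side : Dec (x ∈ F₁) → ⊥
    by-side (yes x∈F₁) with ∈-++⁻ (filter (_∉? xs) F₁) (proj₂ (same x) x∈F₁)
    ... | inj₁ x∈F₁∖xs = proj₂ (∈-filter⁻ (_∉? xs) {xs = F₁} x∈F₁∖xs) x∈xs
    ... | inj₂ x∈xs∖F₁ = proj₂ (∈-filter⁻ (_∉? F₁) {xs = xs} x∈xs∖F₁) x∈F₁
    by-side (no x∉F₁) = x∉F₁ (proj₁ (same x) (∈-++⁺ʳ (filter (_∉? xs) F₁) (∈-filter⁺ (_∉? F₁) x∈xs x∉F₁)))

  symDiff : List Point
  symDiff = filter (_∉? F₂) F₁ ++ filter (_∉? F₁) F₂

  symDiff-unique : Unique F₁ → Unique F₂ → Unique symDiff
  symDiff-unique F₁-unique F₂-unique =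
    Uniqueₚ.++⁺ (Uniqueₚ.filter⁺ (_∉? F₂) F₁-unique) (Uniqueₚ.filter⁺ (_∉? F₁) F₂-unique)
      λ (l , r) → proj₂ (∈-filter⁻ (_∉? F₁) {xs = F₂} r) (proj₁ (∈-filter⁻ (_∉? F₂) {xs = F₁} l))

  symDiff⁺ : ∀ {x} → InSymDiff F₁ F₂ x → x ∈ symDiff
  symDiff⁺ (inj₁ (x∈F₁ , x∉F₂)) = ∈-++⁺ˡ (∈-filter⁺ (_∉? F₂) x∈F₁ x∉F₂)
  symDiff⁺ (inj₂ (x∈F₂ , x∉F₁)) = ∈-++⁺ʳ (filter (_∉? F₂) F₁) (∈-filter⁺ (_∉? F₁) x∈F₂ x∉F₁)

  symDiff⁻ : ∀ {x} → x ∈ symDiff → InSymDiff F₁ F₂ x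
  symDiff⁻ x∈ with ∈-++⁻ (filter (_∉? F₂) F₁) x∈
  ... | inj₁ l = inj₁ (∈-filter⁻ (_∉? F₂) {xs = F₁} l)
  ... | inj₂ r = inj₂ (∈-filter⁻ (_∉? F₁) {xs = F₂} r)

  ∣count-count∣≡∣charge∣ : Unique F₁ → Unique F₂ → ∀ u →
                           ∣ count u F₁ - count u F₂ ∣ ≡ ∣ charge symDiff u ∣
  ∣count-count∣≡∣charge∣ F₁-unique F₂-unique u = begin
    ∣ count u F₁ - count u F₂ ∣
      ≡⟨ cong₂ ∣_-_∣ (count-partition u (_∈? F₂) F₁) (count-partition u (_∈? F₁) F₂) ⟩
    ∣ count u (filter (_∈? F₂) F₁) ℕ.+ a - count u (filter (_∈? F₁) F₂) ℕ.+ b ∣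
      ≡⟨ cong (λ n → ∣ n ℕ.+ a - count u (filter (_∈? F₁) F₂) ℕ.+ b ∣)
              (count-↭ u (filter-∩-↭ _≟ᴾ_ F₁-unique F₂-unique)) ⟩
    ∣ count u (filter (_∈? F₁) F₂) ℕ.+ a - count u (filter (_∈? F₁) F₂) ℕ.+ b ∣
      ≡⟨ ℕP.∣m+n-m+o∣≡∣n-o∣ (count u (filter (_∈? F₁) F₂)) a b ⟩
    ∣ a - b ∣
      ≡⟨ ∣m-n∣≡∣m⊖n∣ a b ⟩
    ∣ a ⊖ b ∣
      ≡⟨ cong ∣_∣ (ℤP.m-n≡m⊖n a b) ⟨
    ∣ + a ℤ.- + b ∣
      ≡⟨ cong ∣_∣ (cong₂ ℤ._+_ (charge-⊆F₁ _ u (proj₁ ∘ ∈-filter⁻ (_∉? F₂) {xs = F₁}))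
                              (charge-⊆∁F₁ _ u (proj₂ ∘ ∈-filter⁻ (_∉? F₁) {xs = F₂}))) ⟨
    ∣ charge (filter (_∉? F₂) F₁) u ℤ.+ charge (filter (_∉? F₁) F₂) u ∣
      ≡⟨ cong ∣_∣ (charge-++ (filter (_∉? F₂) F₁) _ u) ⟨
    ∣ charge symDiff u ∣ ∎
    where
    open ≡-Reasoning
    a b : ℕ
    a = count u (filter (_∉? F₂) F₁)
    b = count u (filter (_∉? F₁) F₂)

  columns rows : List ℤ
  columns = deduplicate ℤP._≟_ (map proj₂ (F₁ ++ F₂))
  rows = deduplicate ℤP._≟_ (map proj₁ (F₁ ++ F₂))

  lines : List Line
  lines = map inj₂ columns ++ map inj₁ rows

  lines-unique : Unique lines
  lines-unique = Uniqueₚ.++⁺ (Uniqueₚ.map⁺ ⊎P.inj₂-injective (deduplicate-! _))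
                             (Uniqueₚ.map⁺ ⊎P.inj₁-injective (deduplicate-! _)) column≢row
    where
    column≢row : ∀ {u} → ¬ (u ∈ map inj₂ columns × u ∈ map inj₁ rows)
    column≢row (l , r) with ∈-map⁻ inj₂ l | ∈-map⁻ inj₁ r
    ... | _ , _ , refl | _ , _ , ()

  ∈-lines : ∀ {x} u → x ∈ F₁ ++ F₂ → OnLine u x → u ∈ lines
  ∈-lines (inj₁ i) x∈ refl = ∈-++⁺ʳ (map inj₂ columns) (∈-map⁺ inj₁ (∈-deduplicate⁺ ℤP._≟_ (∈-map⁺ proj₁ x∈)))
  ∈-lines (inj₂ j) x∈ refl = ∈-++⁺ˡ (∈-map⁺ inj₂ (∈-deduplicate⁺ ℤP._≟_ (∈-map⁺ proj₂ x∈)))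

  open Potential lines lines-unique

  InSymDiff⇒Covered : ∀ {xs} → All (InSymDiff F₁ F₂) xs → Covered xs
  InSymDiff⇒Covered sd u x∈xs with All.lookup sd x∈xs
  ... | inj₁ (x∈F₁ , _) = ∈-lines u (∈-++⁺ˡ x∈F₁)
  ... | inj₂ (x∈F₂ , _) = ∈-lines u (∈-++⁺ʳ F₁ x∈F₂)

  totalDiff≡Φ : Unique F₁ → Unique F₂ → totalDiff F₁ F₂ ≡ Φ symDiff
  totalDiff≡Φ F₁-unique F₂-unique = begin
    totalDiff F₁ F₂
      ≡⟨ cong₂ ℕ._+_ (per-line inj₂ columns) (per-line inj₁ rows) ⟩
    sum (map f (map inj₂ columns)) ℕ.+ sum (map f (map inj₁ rows))
      ≡⟨ sum-++ (map f (map inj₂ columns)) _ ⟨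
    sum (map f (map inj₂ columns) ++ map f (map inj₁ rows))
      ≡⟨ cong sum (map-++ f (map inj₂ columns) _) ⟨
    Φ symDiff ∎
    where
    open ≡-Reasoning
    f : Line → ℕ
    f u = ∣ charge symDiff u ∣
    per-line : ∀ (line : ℤ → Line) ks →
      sum (map (λ k → ∣ count (line k) F₁ - count (line k) F₂ ∣) ks) ≡ sum (map f (map line ks))
    per-line line ks = cong sum (≡-trans (map-cong (∣count-count∣≡∣charge∣ F₁-unique F₂-unique ∘ line) ks) (map-∘ ks))

  InDiffByColour : Bool → Point → Set
  InDiffByColour true = InDiff F₁ F₂
  InDiffByColour false = InDiff F₂ F₁

  inDiffByColour : ∀ {x} → InSymDiff F₁ F₂ x → InDiffByColour (colour x) x
  inDiffByColour {x} = by-side (x ∈? F₁)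
    where
    by-side : (d : Dec (x ∈ F₁)) → InSymDiff F₁ F₂ x → InDiffByColour (does d) x
    by-side (yes _) (inj₁ x∈F₁∖F₂) = x∈F₁∖F₂
    by-side (yes x∈F₁) (inj₂ (_ , x∉F₁)) = ⊥-elim (x∉F₁ x∈F₁)
    by-side (no x∉F₁) (inj₁ (x∈F₁ , _)) = ⊥-elim (x∉F₁ x∈F₁)
    by-side (no _) (inj₂ x∈F₂∖F₁) = x∈F₂∖F₁

  Alternating⇒AltMembership : ∀ {xs} → All (InSymDiff F₁ F₂) xs → Alternating xs → AltMembership F₁ F₂ xs
  Alternating⇒AltMembership [] _ = tt
  Alternating⇒AltMembership (_ ∷ []) _ = tt
  Alternating⇒AltMembership {x ∷ y ∷ _} (x-sd ∷ y-sd ∷ sd) (y-colour , alternating) =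
    opposite (colour x) (inDiffByColour x-sd) (subst (λ c → InDiffByColour c y) y-colour (inDiffByColour y-sd))
    , Alternating⇒AltMembership (y-sd ∷ sd) alternating
    where
    opposite : ∀ c → InDiffByColour c x → InDiffByColour (not c) y →
               (InDiff F₁ F₂ x × InDiff F₂ F₁ y) ⊎ (InDiff F₂ F₁ x × InDiff F₁ F₂ y)
    opposite true x-side y-side = inj₁ (x-side , y-side)
    opposite false x-side y-side = inj₂ (x-side , y-side)

  Decomposition : List Point → ℕ → Set
  Decomposition xs k = Σ (List (List Point)) λ ss →
    length ss ≡ k × All (IsStaircase F₁ F₂) ss × AllPairs Disjoint ss × xs ↭ concat ss

  decompose : Unique F₁ → UniquelyDetermined F₁ → ∀ k xs → Unique xs → All (InSymDiff F₁ F₂) xs →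
              Φ xs ≡ 2 * k → Decomposition xs k
  decompose _ _ zero [] _ _ _ = [] , refl , [] , [] , refl
  decompose F₁-unique determined zero (x ∷ xs) xs-unique sd Φ≡0 =
    ⊥-elim (balanced⇒empty F₁-unique determined xs-unique (Φ≡0⇒balanced (InSymDiff⇒Covered sd) Φ≡0) (here refl))
  decompose F₁-unique determined (suc k) xs xs-unique sd Φ≡ =
    prepend (decompose F₁-unique determined k P.rest rest-unique rest-sd Φ-rest)
    where
    module P = Peeling (peel xs (InSymDiff⇒Covered sd) λ Φ≡0 → ℕP.0≢1+n (≡-trans (sym Φ≡0) Φ≡))
    stair : List Point
    stair = P.start ∷ P.trail
    rest-unique : Unique P.rest
    rest-unique = proj₁ (Unique-++⁻ stair (Unique-resp-↭ P.split xs-unique))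
    stair∩rest : ∀ {x} → x ∈ stair → x ∉ P.rest
    stair∩rest = proj₂ (Unique-++⁻ stair (Unique-resp-↭ P.split xs-unique))
    stair-sd : All (InSymDiff F₁ F₂) stair
    stair-sd = AllP.++⁻ˡ stair (All-resp-↭ P.split sd)
    rest-sd : All (InSymDiff F₁ F₂) P.rest
    rest-sd = AllP.++⁻ʳ stair (All-resp-↭ P.split sd)
    Φ-rest : Φ P.rest ≡ 2 * k
    Φ-rest = ℕP.+-cancelʳ-≡ 2 _ _ (begin
      Φ P.rest ℕ.+ 2   ≡⟨ P.Φ-drop ⟨
      Φ xs             ≡⟨ Φ≡ ⟩
      2 * suc k        ≡⟨ ℕP.*-suc 2 k ⟩
      2 ℕ.+ 2 * k      ≡⟨ ℕP.+-comm 2 (2 * k) ⟩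
      2 * k ℕ.+ 2      ∎)
      where open ≡-Reasoning
    prepend : Decomposition P.rest k → Decomposition xs (suc k)
    prepend (ss , len , stairs , pairwise , rest↭) =
      stair ∷ ss , cong suc len
      , ((λ ()) , stair-sd , Alternating⇒AltMembership stair-sd P.alternating
         , AltSteps-either P.direction stair P.steps) ∷ stairs
      , All.tabulate (λ s∈ss x x∈stair x∈s → stair∩rest x∈stair (∈-resp-↭ (↭-sym rest↭) (∈-concat⁺′ x∈s s∈ss)))
        ∷ pairwise
      , ↭-trans P.split (++⁺ˡ stair rest↭)

lemma2 : (F₁ F₂ : List Point) → IsFinSet F₁ → IsFinSet F₂
       → UniquelyDetermined F₁ → length F₁ ≡ length F₂
       → (α : ℕ) → 2 * α ≡ totalDiff F₁ F₂
       → Σ (List (List Point)) (λ ss → length ss ≡ α × IsStaircaseDecomposition F₁ F₂ ss)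
lemma2 F₁ F₂ F₁-unique F₂-unique determined _ α 2α≡totalDiff =
  decomposition (decompose F₁-unique determined α symDiff (symDiff-unique F₁-unique F₂-unique)
                           (All.tabulate symDiff⁻)
                           (≡-trans (sym (totalDiff≡Φ F₁-unique F₂-unique)) (sym 2α≡totalDiff)))
  where
  open Staircases F₁ F₂
  decomposition : Decomposition symDiff α →
                  Σ (List (List Point)) (λ ss → length ss ≡ α × IsStaircaseDecomposition F₁ F₂ ss)
  decomposition (ss , len , stairs , pairwise , symDiff↭) =
    ss , len , stairs , pairwise ,
    λ p → (∈-concat⁻ ss ∘ ∈-resp-↭ symDiff↭ ∘ symDiff⁺) , (symDiff⁻ ∘ ∈-resp-↭ (↭-sym symDiff↭) ∘ ∈-concat⁺)
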